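{- Let $(\mathcal C,\otimes,I)$ be a monoidal category and let $\perp_R\subseteq\mathcal C(I,R)\times\mathcal C(R,I)$, for each object $R$, be a family of relations satisfying reciprocity: for all $u:I\to R$, $x:S\to I$ and $f:R\to S$, $u\perp_R x\circ f$ if and only if $f\circ u\perp_S x$. Then this family is an orthogonality on $\mathcal C$, i.e. it satisfies the isomorphism, identity and tensor conditions described in the context.
   Context: Isomorphism condition: if $\iota:R\to S$ is an isomorphism then for all $u:I\to R$, $x:R\to I$, $u\perp_R x$ iff $\iota\circ u\perp_S x\circ\iota^{ -1}$. Identity condition: for all $u:I\to R$, $x:R\to I$, $u\perp_R x$ implies $\mathrm{id}_I\perp_I x\circ u$. Tensor condition: for $u:I\to R$, $v:I\to S$ and $h:R\otimes S\to I$, if $u\perp_R h\circ(\mathrm{id}_R\otimes v)$ and $v\perp_S h\circ(u\otimes\mathrm{id}_S)$ then $u\otimes v\perp_{R\otimes S}h$ (with the unit isomorphism $I\cong I\otimes I$ implicit). -}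

module Defs where

open import Level using (Level; _⊔_; suc)
open import Relation.Binary.PropositionalEquality using (_≡_)
open import Data.Product using (_×_)

-- A monoidal category whose hom-sets are types with propositional equality.
record MonoidalCategory (o ℓ : Level) : Set (suc (o ⊔ ℓ)) where
  infixr 9 _∘_
  infixr 10 _⊗₀_ _⊗₁_
  field
    Obj : Set o
    Hom : Obj → Obj → Set ℓ
    id  : ∀ {A} → Hom A A
    _∘_ : ∀ {A B C} → Hom B C → Hom A B → Hom A C
    identityˡ : ∀ {A B} {f : Hom A B} → id ∘ f ≡ f
    identityʳ : ∀ {A B} {f : Hom A B} → f ∘ id ≡ f
    assoc : ∀ {A B C D} {f : Hom A B} {g : Hom B C} {h : Hom C D} →
            (h ∘ g) ∘ f ≡ h ∘ (g ∘ f)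
    _⊗₀_ : Obj → Obj → Obj
    _⊗₁_ : ∀ {A B C D} → Hom A B → Hom C D → Hom (A ⊗₀ C) (B ⊗₀ D)
    ⊗-identity : ∀ {A B} → id {A} ⊗₁ id {B} ≡ id
    ⊗-homomorphism : ∀ {A B C D E F} {f : Hom A B} {g : Hom B C}
                       {h : Hom D E} {k : Hom E F} →
                     (g ∘ f) ⊗₁ (k ∘ h) ≡ (g ⊗₁ k) ∘ (f ⊗₁ h)
    unit : Obj
    unitorˡ⇒ : ∀ {A} → Hom (unit ⊗₀ A) A
    unitorˡ⇐ : ∀ {A} → Hom A (unit ⊗₀ A)
    unitorˡ-isoˡ : ∀ {A} → unitorˡ⇐ {A} ∘ unitorˡ⇒ ≡ id
    unitorˡ-isoʳ : ∀ {A} → unitorˡ⇒ {A} ∘ unitorˡ⇐ ≡ id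
    unitorˡ-natural : ∀ {A B} {f : Hom A B} →
                      f ∘ unitorˡ⇒ ≡ unitorˡ⇒ ∘ (id ⊗₁ f)
    unitorʳ⇒ : ∀ {A} → Hom (A ⊗₀ unit) A
    unitorʳ⇐ : ∀ {A} → Hom A (A ⊗₀ unit)
    unitorʳ-isoˡ : ∀ {A} → unitorʳ⇐ {A} ∘ unitorʳ⇒ ≡ id
    unitorʳ-isoʳ : ∀ {A} → unitorʳ⇒ {A} ∘ unitorʳ⇐ ≡ id
    unitorʳ-natural : ∀ {A B} {f : Hom A B} →
                      f ∘ unitorʳ⇒ ≡ unitorʳ⇒ ∘ (f ⊗₁ id)
    associator⇒ : ∀ {A B C} → Hom ((A ⊗₀ B) ⊗₀ C) (A ⊗₀ (B ⊗₀ C))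
    associator⇐ : ∀ {A B C} → Hom (A ⊗₀ (B ⊗₀ C)) ((A ⊗₀ B) ⊗₀ C)
    associator-isoˡ : ∀ {A B C} → associator⇐ {A} {B} {C} ∘ associator⇒ ≡ id
    associator-isoʳ : ∀ {A B C} → associator⇒ {A} {B} {C} ∘ associator⇐ ≡ id
    associator-natural : ∀ {A A′ B B′ C C′}
                           {f : Hom A A′} {g : Hom B B′} {h : Hom C C′} →
                         (f ⊗₁ (g ⊗₁ h)) ∘ associator⇒ ≡
                         associator⇒ ∘ ((f ⊗₁ g) ⊗₁ h)
    triangle : ∀ {A B} →
               (id {A} ⊗₁ unitorˡ⇒ {B}) ∘ associator⇒ ≡ unitorʳ⇒ ⊗₁ id
    pentagon : ∀ {A B C D} →
               (id {A} ⊗₁ associator⇒ {B} {C} {D}) ∘ associator⇒ ∘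
                 (associator⇒ ⊗₁ id) ≡ associator⇒ ∘ associator⇒

module _ {o ℓ : Level} (C : MonoidalCategory o ℓ) where
  open MonoidalCategory C

  record Iso (R S : Obj) : Set ℓ where
    field
      to   : Hom R S
      from : Hom S R
      isoˡ : from ∘ to ≡ id
      isoʳ : to ∘ from ≡ id

  OrthRel : (p : Level) → Set (o ⊔ ℓ ⊔ suc p)
  OrthRel p = (R : Obj) → Hom unit R → Hom R unit → Set p

  module _ {p : Level} (⊥ : OrthRel p) where

    Reciprocity : Set (o ⊔ ℓ ⊔ p)
    Reciprocity = ∀ {R S} (u : Hom unit R) (x : Hom S unit) (f : Hom R S) →
                  (⊥ R u (x ∘ f) → ⊥ S (f ∘ u) x) × (⊥ S (f ∘ u) x → ⊥ R u (x ∘ f))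

    IsomorphismCondition : Set (o ⊔ ℓ ⊔ p)
    IsomorphismCondition = ∀ {R S} (ι : Iso R S) (u : Hom unit R) (x : Hom R unit) →
      let open Iso ι in
      (⊥ R u x → ⊥ S (to ∘ u) (x ∘ from)) × (⊥ S (to ∘ u) (x ∘ from) → ⊥ R u x)

    IdentityCondition : Set (o ⊔ ℓ ⊔ p)
    IdentityCondition = ∀ {R} (u : Hom unit R) (x : Hom R unit) →
      ⊥ R u x → ⊥ unit id (x ∘ u)

    -- the implicit unit isomorphisms: R ≅ R ⊗ I, S ≅ I ⊗ S, I ≅ I ⊗ I (via ρ_I)
    TensorCondition : Set (o ⊔ ℓ ⊔ p)
    TensorCondition = ∀ {R S} (u : Hom unit R) (v : Hom unit S)
      (h : Hom (R ⊗₀ S) unit) →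
      ⊥ R u (h ∘ (id ⊗₁ v) ∘ unitorʳ⇐) →
      ⊥ S v (h ∘ (u ⊗₁ id) ∘ unitorˡ⇐) →
      ⊥ (R ⊗₀ S) ((u ⊗₁ v) ∘ unitorʳ⇐) h

    record IsOrthogonality : Set (o ⊔ ℓ ⊔ p) where
      field
        isomorphism : IsomorphismCondition
        identity    : IdentityCondition
        tensor      : TensorCondition

-- Reciprocity lets a morphism f : R → S move between the two sides of ⊥.
-- For an isomorphism ι, move ι across: u ⊥ x ∘ ι⁻¹ ∘ ι iff ι ∘ u ⊥ x ∘ ι⁻¹.
-- For the identity condition, move u across: id ⊥ x ∘ u iff u ∘ id ⊥ x.
-- For the tensor condition, move (id ⊗ v) ∘ ρ⁻¹ : R → R ⊗ S across; the
-- first hypothesis alone then yields (id ⊗ v) ∘ ρ⁻¹ ∘ u = (u ⊗ v) ∘ ρ⁻¹ ⊥ h.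
module Submission where

open import Defs
open import Level using (Level)
open import Data.Product using (_,_; proj₁; proj₂)
open import Relation.Binary.PropositionalEquality

module MonoidalReasoning {o ℓ : Level} (C : MonoidalCategory o ℓ) where
  open MonoidalCategory C
  open ≡-Reasoning

  cancelʳ : ∀ {A B D} {f : Hom A B} {g : Hom B A} (h : Hom A D) →
            g ∘ f ≡ id → (h ∘ g) ∘ f ≡ h
  cancelʳ h gf≡id = begin
    (h ∘ _) ∘ _  ≡⟨ assoc ⟩
    h ∘ (_ ∘ _)  ≡⟨ cong (h ∘_) gf≡id ⟩
    h ∘ id       ≡⟨ identityʳ ⟩
    h            ∎

  inverse-naturality : ∀ {A A′ B B′} {f : Hom A B} {g : Hom A′ B′}
                         {r : Hom A′ A} {s : Hom A A′} {r′ : Hom B′ B} {s′ : Hom B B′} →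
                       f ∘ r ≡ r′ ∘ g → r ∘ s ≡ id → s′ ∘ r′ ≡ id →
                       s′ ∘ f ≡ g ∘ s
  inverse-naturality {f = f} {g} {r} {s} {r′} {s′} natural rs≡id s′r′≡id = begin
    s′ ∘ f              ≡⟨ sym (cancelʳ (s′ ∘ f) rs≡id) ⟩
    ((s′ ∘ f) ∘ r) ∘ s  ≡⟨ cong (_∘ s) assoc ⟩
    (s′ ∘ (f ∘ r)) ∘ s  ≡⟨ cong (λ k → (s′ ∘ k) ∘ s) natural ⟩
    (s′ ∘ (r′ ∘ g)) ∘ s ≡⟨ cong (_∘ s) (sym assoc) ⟩
    ((s′ ∘ r′) ∘ g) ∘ s ≡⟨ cong (λ k → (k ∘ g) ∘ s) s′r′≡id ⟩
    (id ∘ g) ∘ s        ≡⟨ cong (_∘ s) identityˡ ⟩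
    g ∘ s               ∎

  unitorʳ⇐-natural : ∀ {A B} {f : Hom A B} → unitorʳ⇐ ∘ f ≡ (f ⊗₁ id) ∘ unitorʳ⇐
  unitorʳ⇐-natural = inverse-naturality unitorʳ-natural unitorʳ-isoʳ unitorʳ-isoˡ

  ⊗-split : ∀ {A B C D} (f : Hom A B) (g : Hom C D) → (id ⊗₁ g) ∘ (f ⊗₁ id) ≡ f ⊗₁ g
  ⊗-split f g = begin
    (id ⊗₁ g) ∘ (f ⊗₁ id) ≡⟨ sym ⊗-homomorphism ⟩
    (id ∘ f) ⊗₁ (g ∘ id)  ≡⟨ cong₂ _⊗₁_ identityˡ identityʳ ⟩
    f ⊗₁ g                ∎

  whiskerʳ-unitorʳ⇐ : ∀ {R S} (u : Hom unit R) (v : Hom unit S) →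
                      ((id ⊗₁ v) ∘ unitorʳ⇐) ∘ u ≡ (u ⊗₁ v) ∘ unitorʳ⇐
  whiskerʳ-unitorʳ⇐ u v = begin
    ((id ⊗₁ v) ∘ unitorʳ⇐) ∘ u          ≡⟨ assoc ⟩
    (id ⊗₁ v) ∘ (unitorʳ⇐ ∘ u)          ≡⟨ cong ((id ⊗₁ v) ∘_) unitorʳ⇐-natural ⟩
    (id ⊗₁ v) ∘ ((u ⊗₁ id) ∘ unitorʳ⇐)  ≡⟨ sym assoc ⟩
    ((id ⊗₁ v) ∘ (u ⊗₁ id)) ∘ unitorʳ⇐  ≡⟨ cong (_∘ unitorʳ⇐) (⊗-split u v) ⟩
    (u ⊗₁ v) ∘ unitorʳ⇐                 ∎

module FromReciprocity {o ℓ p : Level} (C : MonoidalCategory o ℓ) (⊥ : OrthRel C p)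
                       (reciprocity : Reciprocity C ⊥) where
  open MonoidalCategory C
  open MonoidalReasoning C

  push : ∀ {R S} (u : Hom unit R) (x : Hom S unit) (f : Hom R S) →
         ⊥ R u (x ∘ f) → ⊥ S (f ∘ u) x
  push u x f = proj₁ (reciprocity u x f)

  pull : ∀ {R S} (u : Hom unit R) (x : Hom S unit) (f : Hom R S) →
         ⊥ S (f ∘ u) x → ⊥ R u (x ∘ f)
  pull u x f = proj₂ (reciprocity u x f)

  isomorphism : IsomorphismCondition C ⊥
  isomorphism ι u x =
      (λ u⊥x → push u (x ∘ from) to (subst (⊥ _ u) (sym x∘from∘to≡x) u⊥x))
    , (λ ιu⊥xι⁻¹ → subst (⊥ _ u) x∘from∘to≡x (pull u (x ∘ from) to ιu⊥xι⁻¹))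
    where
    open Iso ι
    x∘from∘to≡x : (x ∘ from) ∘ to ≡ x
    x∘from∘to≡x = cancelʳ x isoˡ

  identity : IdentityCondition C ⊥
  identity {R} u x u⊥x = pull id x u (subst (λ w → ⊥ R w x) (sym identityʳ) u⊥x)

  tensor : TensorCondition C ⊥
  tensor {R} {S} u v h u⊥h[id⊗v] _ =
    subst (λ w → ⊥ (R ⊗₀ S) w h) (whiskerʳ-unitorʳ⇐ u v)
          (push u h ((id ⊗₁ v) ∘ unitorʳ⇐) u⊥h[id⊗v])

lemma4p10 : ∀ {o ℓ p : Level} (C : MonoidalCategory o ℓ) (⊥ : OrthRel C p) →
    Reciprocity C ⊥ → IsOrthogonality C ⊥
lemma4p10 C ⊥ reciprocity = record
  { isomorphism = isomorphism
  ; identity    = identity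
  ; tensor      = tensor
  }
  where open FromReciprocity C ⊥ reciprocity
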